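{- Let $\Gamma$ be a finite simple graph. Then no two adjacent vertices of the structure $S\Omega(\Gamma)$ of its complete skeleton are structurally equivalent in $S\Omega(\Gamma)$.
   Context: Two vertices $u,v$ of a graph $G$ are structurally equivalent if the transposition $(u\,v)$ (swapping $u,v$, fixing other vertices) is an automorphism of $G$. Consider partitions of $V(\Gamma)$ into nonempty parts such that each part induces a complete subgraph of $\Gamma$ and, for any two distinct parts $P,Q$, either every vertex of $P$ is adjacent to every vertex of $Q$ or no vertex of $P$ is adjacent to any vertex of $Q$. The complete skeleton $\Omega(\Gamma)$ is such a partition with the minimum number of parts; its structure $S\Omega(\Gamma)$ is the simple graph whose vertices are the parts, two parts being adjacent iff they are completely joined. -}

module Defs where

open import Data.Nat using (ℕ; _≤_)
open import Data.Fin using (Fin)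
open import Data.Product using (Σ; ∃; _×_)
open import Data.Sum using (_⊎_)
open import Relation.Nullary using (¬_; Dec)
open import Relation.Binary.PropositionalEquality using (_≡_; _≢_)
open import Data.Fin.Permutation.Components using (transpose)

record SimpleGraph (n : ℕ) : Set₁ where
  field
    Adj    : Fin n → Fin n → Set
    adj?   : (u v : Fin n) → Dec (Adj u v)
    sym    : ∀ {u v} → Adj u v → Adj v u
    irrefl : ∀ {u} → ¬ Adj u u
open SimpleGraph public

StructEquiv : ∀ {n} → (Fin n → Fin n → Set) → Fin n → Fin n → Set
StructEquiv {n} Adj u v =
  (x y : Fin n) →
    (Adj x y → Adj (transpose u v x) (transpose u v y)) ×
    (Adj (transpose u v x) (transpose u v y) → Adj x y)

record AdmissiblePartition {n : ℕ} (Γ : SimpleGraph n) (k : ℕ) : Set where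
  field
    part     : Fin n → Fin k
    nonempty : (a : Fin k) → ∃ λ u → part u ≡ a
    clique   : ∀ u v → part u ≡ part v → u ≢ v → Adj Γ u v
    homog    : (a b : Fin k) → a ≢ b →
               ((u v : Fin n) → part u ≡ a → part v ≡ b → Adj Γ u v) ⊎
               ((u v : Fin n) → part u ≡ a → part v ≡ b → ¬ Adj Γ u v)
open AdmissiblePartition public

record CompleteSkeleton {n : ℕ} (Γ : SimpleGraph n) (k : ℕ) : Set₁ where
  field
    partition : AdmissiblePartition Γ k
    minimal   : (k′ : ℕ) → AdmissiblePartition Γ k′ → k ≤ k′
open CompleteSkeleton public

StructAdj : ∀ {n k} {Γ : SimpleGraph n} → AdmissiblePartition Γ k →
            Fin k → Fin k → Set
StructAdj {n} {k} {Γ} P a b =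
  a ≢ b × ((u v : Fin n) → part P u ≡ a → part P v ≡ b → Adj Γ u v)

{-# OPTIONS --safe #-}
module Submission where

-- If two adjacent parts a, b of SΩ(Γ) were structurally equivalent, they would have the same
-- neighbours among the other parts. Then the union of the two parts is still a clique which is
-- homogeneous towards every other part, so merging them gives an admissible partition with one
-- part fewer, contradicting the minimality of Ω.

open import Defs hiding (sym)
open import Data.Nat using (ℕ; suc)
open import Data.Nat.Properties using (n≮n)
open import Data.Fin using (Fin; punchOut; punchIn; _≟_)
open import Data.Fin.Properties
  using (punchOut-injective; punchOut-cong; punchOut-punchIn; punchInᵢ≢i)
open import Data.Fin.Permutation.Components using (transpose)
open import Data.Product using (_×_; _,_; proj₁; proj₂; ∃)
open import Data.Sum using (_⊎_; inj₁; inj₂)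
open import Function using (_∘_)
open import Function.Bundles using (_⇔_; mk⇔; Equivalence)
open import Function.Construct.Identity using (⇔-id)
open import Function.Construct.Symmetry using (⇔-sym)
open import Relation.Nullary using (¬_; yes; no; contradiction)
open import Relation.Binary.PropositionalEquality

open Equivalence using (to; from)

transpose-matchˡ : ∀ {m} (i j : Fin m) → transpose i j i ≡ j
transpose-matchˡ i j with i ≟ i
... | yes _   = refl
... | no i≢i  = contradiction refl i≢i

transpose-matchʳ : ∀ {m} (i j : Fin m) → transpose i j j ≡ i
transpose-matchʳ i j with j ≟ i
... | yes j≡i = j≡i
... | no _ with j ≟ j
...   | yes _   = refl
...   | no j≢j  = contradiction refl j≢j

transpose-other : ∀ {m} (i j k : Fin m) → k ≢ i → k ≢ j → transpose i j k ≡ k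
transpose-other i j k k≢i k≢j with k ≟ i
... | yes k≡i = contradiction k≡i k≢i
... | no _ with k ≟ j
...   | yes k≡j = contradiction k≡j k≢j
...   | no _    = refl

structEquiv-neighbour : ∀ {m} {R : Fin m → Fin m → Set} {u v w : Fin m} →
                        StructEquiv R u v → w ≢ u → w ≢ v → R u w ⇔ R v w
structEquiv-neighbour {R = R} {u} {v} {w} E w≢u w≢v = mk⇔
  (subst₂ R (transpose-matchˡ u v) (transpose-other u v w w≢u w≢v) ∘ proj₁ (E u w))
  (subst₂ R (transpose-matchʳ u v) (transpose-other u v w w≢u w≢v) ∘ proj₁ (E v w))

module _ {n k : ℕ} {Γ : SimpleGraph n} (P : AdmissiblePartition Γ k) where

  Joined : Fin k → Fin k → Set
  Joined c d = (u v : Fin n) → part P u ≡ c → part P v ≡ d → Adj Γ u v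

  Apart : Fin k → Fin k → Set
  Apart c d = (u v : Fin n) → part P u ≡ c → part P v ≡ d → ¬ Adj Γ u v

  joined-sym : ∀ {c d} → Joined c d → Joined d c
  joined-sym c⋈d u v u∈d v∈c = SimpleGraph.sym Γ (c⋈d v u v∈c u∈d)

  joined⇒¬apart : ∀ {c d} → Joined c d → ¬ Apart c d
  joined⇒¬apart {c} {d} c⋈d c∥d with nonempty P c | nonempty P d
  ... | u , u∈c | v , v∈d = c∥d u v u∈c v∈d (c⋈d u v u∈c v∈d)

  structEquiv⇒twins : ∀ {a b d} → StructEquiv (StructAdj P) a b → d ≢ a → d ≢ b →
                      Joined a d ⇔ Joined b d
  structEquiv⇒twins {a} {b} {d} E d≢a d≢b = mk⇔
    (proj₂ ∘ to a~b ∘ (≢-sym d≢a ,_))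
    (proj₂ ∘ from a~b ∘ (≢-sym d≢b ,_))
    where
    a~b : StructAdj P a d ⇔ StructAdj P b d
    a~b = structEquiv-neighbour E d≢a d≢b

  coarsen : ∀ {m} (g : Fin k → Fin m) →
            (∀ t → ∃ λ c → g c ≡ t) →
            (∀ {c d} → c ≢ d → g c ≡ g d → Joined c d) →
            (∀ {c c′ d} → g c ≡ g c′ → g c ≢ g d → Joined c d → Joined c′ d) →
            AdmissiblePartition Γ m
  coarsen {m} g g-surjective identified-joined joined-respects = record
    { part     = g ∘ part P
    ; nonempty = nonempty′
    ; clique   = clique′
    ; homog    = homog′
    }
    where
    joined-respects₂ : ∀ {c c′ d d′} → g c ≡ g c′ → g d ≡ g d′ → g c ≢ g d →
                       Joined c d → Joined c′ d′
    joined-respects₂ c~c′ d~d′ c≁d =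
      joined-sym ∘ joined-respects d~d′ (c≁d ∘ trans c~c′ ∘ sym)
        ∘ joined-sym ∘ joined-respects c~c′ c≁d

    nonempty′ : (t : Fin m) → ∃ λ u → g (part P u) ≡ t
    nonempty′ t with g-surjective t
    ... | c , gc≡t with nonempty P c
    ...   | u , u∈c = u , trans (cong g u∈c) gc≡t

    clique′ : ∀ u v → g (part P u) ≡ g (part P v) → u ≢ v → Adj Γ u v
    clique′ u v same u≢v with part P u ≟ part P v
    ... | yes u~v = clique P u v u~v u≢v
    ... | no u≁v  = identified-joined u≁v same u v refl refl

    images-≢ : ∀ {c d s t} → s ≢ t → g c ≡ s → g d ≡ t → g c ≢ g d
    images-≢ s≢t gc≡s gd≡t gc≡gd = s≢t (trans (sym gc≡s) (trans gc≡gd gd≡t))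

    homog′ : (s t : Fin m) → s ≢ t →
             ((u v : Fin n) → g (part P u) ≡ s → g (part P v) ≡ t → Adj Γ u v) ⊎
             ((u v : Fin n) → g (part P u) ≡ s → g (part P v) ≡ t → ¬ Adj Γ u v)
    homog′ s t s≢t with g-surjective s | g-surjective t
    ... | c , gc≡s | d , gd≡t with homog P c d (images-≢ s≢t gc≡s gd≡t ∘ cong g)
    ...   | inj₁ c⋈d = inj₁ λ u v u↦s v↦t →
            joined-respects₂ (trans gc≡s (sym u↦s)) (trans gd≡t (sym v↦t))
              (images-≢ s≢t gc≡s gd≡t) c⋈d u v refl refl
    ...   | inj₂ c∥d = inj₂ apart
      where
      apart : (u v : Fin n) → g (part P u) ≡ s → g (part P v) ≡ t → ¬ Adj Γ u v
      apart u v u↦s v↦t adj with homog P (part P u) (part P v) (images-≢ s≢t u↦s v↦t ∘ cong g)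
      ... | inj₁ u⋈v = joined⇒¬apart (joined-respects₂ (trans u↦s (sym gc≡s)) (trans v↦t (sym gd≡t))
                                        (images-≢ s≢t u↦s v↦t) u⋈v) c∥d
      ... | inj₂ u∥v = u∥v u v refl refl adj

mergeTwins : ∀ {n k} {Γ : SimpleGraph n} (P : AdmissiblePartition Γ (suc k)) {a b : Fin (suc k)} →
             a ≢ b → Joined P a b → (∀ {d} → d ≢ a → d ≢ b → Joined P a d ⇔ Joined P b d) →
             AdmissiblePartition Γ k
mergeTwins {k = k} P {a} {b} a≢b a⋈b twins =
  coarsen P merge merge-surjective identified-joined joined-respects
  where
  rep : Fin (suc k) → Fin (suc k)
  rep c with c ≟ b
  ... | yes _ = a
  ... | no _  = c

  b≢rep : ∀ c → b ≢ rep c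
  b≢rep c with c ≟ b
  ... | yes _  = a≢b ∘ sym
  ... | no c≢b = c≢b ∘ sym

  rep-fixes : ∀ {c} → c ≢ b → rep c ≡ c
  rep-fixes {c} c≢b with c ≟ b
  ... | yes c≡b = contradiction c≡b c≢b
  ... | no _    = refl

  rep-b : rep b ≡ a
  rep-b with b ≟ b
  ... | yes _  = refl
  ... | no b≢b = contradiction refl b≢b

  merge : Fin (suc k) → Fin k
  merge c = punchOut (b≢rep c)

  merge-surjective : ∀ t → ∃ λ c → merge c ≡ t
  merge-surjective t =
    punchIn b t , trans (punchOut-cong b (rep-fixes (punchInᵢ≢i b t))) (punchOut-punchIn b)

  merge-rep : ∀ {c d} → merge c ≡ merge d → rep c ≡ rep d
  merge-rep {c} {d} = punchOut-injective (b≢rep c) (b≢rep d)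

  rep-identified-joined : ∀ {c d} → c ≢ d → rep c ≡ rep d → Joined P c d
  rep-identified-joined {c} {d} c≢d c~d with c ≟ b | d ≟ b
  rep-identified-joined c≢d _    | yes refl | yes refl = contradiction refl c≢d
  rep-identified-joined c≢d refl | yes refl | no _     = joined-sym P a⋈b
  rep-identified-joined c≢d refl | no _     | yes refl = a⋈b
  rep-identified-joined c≢d c≡d  | no _     | no _     = contradiction c≡d c≢d

  identified-joined : ∀ {c d} → c ≢ d → merge c ≡ merge d → Joined P c d
  identified-joined {c} {d} c≢d = rep-identified-joined c≢d ∘ merge-rep {c} {d}

  joined-rep : ∀ {c d} → rep c ≢ rep d → Joined P c d ⇔ Joined P (rep c) d
  joined-rep {c} {d} c≁d with c ≟ b
  ... | yes refl = ⇔-sym (twins d≢a d≢b)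
    where
    d≢a : d ≢ a
    d≢a refl = c≁d (sym (rep-fixes a≢b))
    d≢b : d ≢ b
    d≢b refl = c≁d (sym rep-b)
  ... | no _ = ⇔-id _

  joined-respects : ∀ {c c′ d} → merge c ≡ merge c′ → merge c ≢ merge d →
                    Joined P c d → Joined P c′ d
  joined-respects {c} {c′} {d} c~c′ c≁d =
    from (joined-rep {c′} c′≁d) ∘ subst (λ x → Joined P x d) (merge-rep {c} {c′} c~c′)
      ∘ to (joined-rep {c} rep-c≁d)
    where
    rep-c≁d : rep c ≢ rep d
    rep-c≁d = c≁d ∘ punchOut-cong b
    c′≁d : rep c′ ≢ rep d
    c′≁d = rep-c≁d ∘ trans (merge-rep {c} {c′} c~c′)

corollary4p3 : (n : ℕ) (Γ : SimpleGraph n) (k : ℕ) (Ω : CompleteSkeleton Γ k) →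
    (a b : Fin k) →
      ¬ (StructAdj (partition Ω) a b × StructEquiv (StructAdj (partition Ω)) a b)
corollary4p3 n Γ (suc k) Ω a b ((a≢b , a⋈b) , E) =
  n≮n k (minimal Ω k (mergeTwins (partition Ω) a≢b a⋈b (structEquiv⇒twins (partition Ω) E)))
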